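{- For any game with activeness $G^g$ and any $b\in\{0,1\}$, $o(G^g+G^g+\emptyset^b)=\mathscr{P}$.
   Context: Let $\mathcal{B}=\{0,1\}$. Define $\mathbb{I}_0=\{\emptyset\}\times\mathcal{B}$ and $\mathbb{I}_n=2^{\mathbb{I}_{n-1}}\times\mathcal{B}$ for $n\ge1$; a game with activeness is an element of $\mathbb{I}=\bigcup_{n\ge0}\mathbb{I}_n$. A pair $(G,g)$ is written $G^g$; elements of $G$ are its options, $g=1$ meaning active. The outcome $o$ is defined recursively: $o(G^g)=\mathscr{N}$ if $g=1$ and some option has outcome $\mathscr{P}$, and $o(G^g)=\mathscr{P}$ otherwise. The sum is $G^g+H^h=(\{G'^{g'}+H^h:G'^{g'}\in G^g\}\cup\{G^g+H'^{h'}:H'^{h'}\in H^h\})^{\max\{g,h\}}$; it is associative. -}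

module Defs where

open import Data.Bool using (Bool; true; false; _∨_; _∧_)
open import Data.List using (List; []; _∷_; _++_)

-- A game with activeness G^g: a finite set of options (represented as a list;
-- order/duplicates are irrelevant for the outcome) together with an
-- activeness bit g ∈ B = {0,1} (true = active = 1).
data Game : Set where
  mk : List Game → Bool → Game

data Outcome : Set where
  𝒩 𝒫 : Outcome

mutual
  o : Game → Outcome
  o (mk Gs g) with g ∧ someP Gs
  ... | true  = 𝒩
  ... | false = 𝒫

  someP : List Game → Bool
  someP [] = false
  someP (G ∷ Gs) with o G
  ... | 𝒫 = true
  ... | 𝒩 = someP Gs

infixl 6 _⊕_

mutual
  _⊕_ : Game → Game → Game
  G@(mk Gs g) ⊕ H@(mk Hs h) = mk (lefts Gs H ++ rights G Hs) (g ∨ h)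

  lefts : List Game → Game → List Game
  lefts [] H = []
  lefts (G' ∷ Gs) H = (G' ⊕ H) ∷ lefts Gs H

  rights : Game → List Game → List Game
  rights G [] = []
  rights G (H' ∷ Hs) = (G ⊕ H') ∷ rights G Hs

∅ : Bool → Game
∅ b = mk [] b

module Submission where

open import Defs
open import Data.Bool using (Bool; true; false; T; _∨_)
open import Data.Bool.Properties using (T-∨)
open import Data.List using (List; []; _∷_; _++_; map)
open import Data.List.Membership.Propositional using (_∈_)
open import Data.List.Membership.Propositional.Properties using (∈-map⁺; ∈-++⁺ˡ; ∈-++⁺ʳ)
open import Data.List.Relation.Unary.Any using (here; there)
open import Data.List.Relation.Unary.All using (All; []; _∷_; tabulate; lookup)
open import Data.List.Relation.Unary.All.Properties using (++⁺; map⁺)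
open import Data.Sum using (_⊎_; inj₁; inj₂; map₁)
open import Data.Unit using (tt)
open import Function.Bundles using (Equivalence)
open import Relation.Binary.PropositionalEquality using (_≡_; refl; cong)

-- Tweedledum–Tweedledee: every move in G + G + ∅^b, to G' + G or G + G', is
-- answered by the mirror move to G' + G' + ∅^b, which is 𝒫 by induction. So if
-- the sum is active, each of its options is active with a 𝒫 option, hence 𝒩,
-- and the sum is 𝒫; if it is inactive it is 𝒫 outright.

options : Game → List Game
options (mk Gs _) = Gs

active : Game → Bool
active (mk _ g) = g

someP≡true : ∀ {x Gs} → x ∈ Gs → o x ≡ 𝒫 → someP Gs ≡ true
someP≡true {Gs = y ∷ _} (here refl) x𝒫 with o y
... | 𝒫 = refl
someP≡true {Gs = y ∷ _} (there x∈) x𝒫 with o y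
... | 𝒫 = refl
... | 𝒩 = someP≡true x∈ x𝒫

someP≡false : ∀ {Gs} → All (λ x → o x ≡ 𝒩) Gs → someP Gs ≡ false
someP≡false [] = refl
someP≡false {x ∷ _} (x𝒩 ∷ xs𝒩) with o x
someP≡false (refl ∷ xs𝒩) | 𝒩 = someP≡false xs𝒩

o≡𝒩 : ∀ {x} G → T (active G) → x ∈ options G → o x ≡ 𝒫 → o G ≡ 𝒩
o≡𝒩 (mk _ true) _ x∈ x𝒫 rewrite someP≡true x∈ x𝒫 = refl

o≡𝒫 : ∀ G → All (λ x → o x ≡ 𝒩) (options G) → o G ≡ 𝒫
o≡𝒫 (mk _ g) all𝒩 rewrite someP≡false all𝒩 with g
... | true  = refl
... | false = refl

lefts≡map : ∀ Gs H → lefts Gs H ≡ map (_⊕ H) Gs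
lefts≡map []       H = refl
lefts≡map (G ∷ Gs) H = cong (G ⊕ H ∷_) (lefts≡map Gs H)

rights≡map : ∀ G Hs → rights G Hs ≡ map (G ⊕_) Hs
rights≡map G []       = refl
rights≡map G (H ∷ Hs) = cong (G ⊕ H ∷_) (rights≡map G Hs)

options-⊕ : ∀ G H → options (G ⊕ H) ≡ map (_⊕ H) (options G) ++ map (G ⊕_) (options H)
options-⊕ G@(mk Gs _) H@(mk Hs _) rewrite lefts≡map Gs H | rights≡map G Hs = refl

∈-options-⊕ˡ : ∀ {x} G H → x ∈ options G → x ⊕ H ∈ options (G ⊕ H)
∈-options-⊕ˡ G H x∈ rewrite options-⊕ G H = ∈-++⁺ˡ (∈-map⁺ (_⊕ H) x∈)

∈-options-⊕ʳ : ∀ {y} G H → y ∈ options H → G ⊕ y ∈ options (G ⊕ H)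
∈-options-⊕ʳ G H y∈ rewrite options-⊕ G H = ∈-++⁺ʳ (map (_⊕ H) (options G)) (∈-map⁺ (G ⊕_) y∈)

All-options-⊕ : ∀ {P : Game → Set} G H →
                All (λ x → P (x ⊕ H)) (options G) → All (λ y → P (G ⊕ y)) (options H) →
                All P (options (G ⊕ H))
All-options-⊕ G H Pˡ Pʳ rewrite options-⊕ G H = ++⁺ (map⁺ Pˡ) (map⁺ Pʳ)

active-⊕ : ∀ G H → T (active G) ⊎ T (active H) → T (active (G ⊕ H))
active-⊕ (mk _ g) (mk _ h) = Equivalence.from T-∨

mirror-𝒫-step : ∀ G b → T (active G ∨ b) →
                (∀ {K} → K ∈ options G → o (K ⊕ K ⊕ ∅ b) ≡ 𝒫) →
                o (G ⊕ G ⊕ ∅ b) ≡ 𝒫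
mirror-𝒫-step G b G∨b ih =
  o≡𝒫 (G ⊕ G ⊕ ∅ b)
    (All-options-⊕ (G ⊕ G) (∅ b)
      (All-options-⊕ G G (tabulate moveˡ𝒩) (tabulate moveʳ𝒩))
      [])
  where
  G∨∅ : T (active G) ⊎ T (active (∅ b))
  G∨∅ = Equivalence.to T-∨ G∨b

  moveˡ𝒩 : ∀ {K} → K ∈ options G → o (K ⊕ G ⊕ ∅ b) ≡ 𝒩
  moveˡ𝒩 {K} K∈ =
    o≡𝒩 (K ⊕ G ⊕ ∅ b)
      (active-⊕ (K ⊕ G) (∅ b) (map₁ (λ g → active-⊕ K G (inj₂ g)) G∨∅))
      (∈-options-⊕ˡ (K ⊕ G) (∅ b) (∈-options-⊕ʳ K G K∈))
      (ih K∈)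

  moveʳ𝒩 : ∀ {K} → K ∈ options G → o (G ⊕ K ⊕ ∅ b) ≡ 𝒩
  moveʳ𝒩 {K} K∈ =
    o≡𝒩 (G ⊕ K ⊕ ∅ b)
      (active-⊕ (G ⊕ K) (∅ b) (map₁ (λ g → active-⊕ G K (inj₁ g)) G∨∅))
      (∈-options-⊕ˡ (G ⊕ K) (∅ b) (∈-options-⊕ˡ G K K∈))
      (ih K∈)

mutual
  mirror-𝒫 : ∀ b G → o (G ⊕ G ⊕ ∅ b) ≡ 𝒫
  mirror-𝒫 false (mk _ false) = refl
  mirror-𝒫 true  G@(mk Gs false) = mirror-𝒫-step G true tt (lookup (mirror-𝒫-all true Gs))
  mirror-𝒫 b     G@(mk Gs true)  = mirror-𝒫-step G b tt (lookup (mirror-𝒫-all b Gs))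

  mirror-𝒫-all : ∀ b Gs → All (λ K → o (K ⊕ K ⊕ ∅ b) ≡ 𝒫) Gs
  mirror-𝒫-all b []       = []
  mirror-𝒫-all b (K ∷ Ks) = mirror-𝒫 b K ∷ mirror-𝒫-all b Ks

theorem3p12 : (G : Game) (b : Bool) → o (G ⊕ G ⊕ ∅ b) ≡ 𝒫
theorem3p12 G b = mirror-𝒫 b G
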